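{- Let $\omega\in S_n$. If $M_\omega$ has a $C_4$-parallelogram-pattern, then $M_\omega$ has a parallelogram-pattern.
   Context: Permutations are in one-line notation. ${\rm Inv}(\omega)=\{(i,j): 1\le i<j\le n,\ \omega(i)>\omega(j)\}$; $c_i(\omega)=\#\{j>i: \omega(i)>\omega(j)\}$; for $i<j$, $c_{i,j}(\omega)=\#\{k: i<k<j,\ \omega(i)>\omega(k)\}$; $[m]=\{1,\dots,m\}$. For $c_i(\omega)>0$ and $x\in[c_i(\omega)]$, $m_{i,x}(\omega)\in\mathbb{N}^n$ has $j$-th coordinate: $0$ if $(i,j)\in{\rm Inv}(\omega)$; $0$ if $j<i$; $x$ if $j=i$; $\max\{0,x-c_{i,j}(\omega)\}$ if $j>i$ and $(i,j)\notin{\rm Inv}(\omega)$. $M_\omega$ is the set of all $m_{i,x}(\omega)$, ordered componentwise. For $1\le i<j\le n$, $b<a$ in $[c_i(\omega)]$, $c<d$ in $[c_j(\omega)]$ with $a+c=b+d$: the set $\{m_{i,a}(\omega),m_{i,b}(\omega),m_{j,c}(\omega),m_{j,d}(\omega)\}$ is a parallelogram-pattern poset if $m_{i,a}(\omega)>m_{j,d}(\omega)$, $m_{i,b}(\omega)>m_{j,c}(\omega)$, and $m_{i,b}(\omega)$, $m_{j,d}(\omega)$ are incomparable; it is a $C_4$-parallelogram-pattern poset if $m_{i,a}(\omega)>m_{j,d}(\omega)$, $m_{i,b}(\omega)>m_{j,c}(\omega)$, and $m_{i,b}(\omega)$, $m_{j,d}(\omega)$ are comparable. $M_\omega$ has a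 (resp. $C_4$-)parallelogram-pattern if it contains such a set. -}

module Defs where

open import Data.Nat using (ℕ; zero; suc; _+_; _∸_; _≤_; _<_; _<ᵇ_)
open import Data.Fin using (Fin; toℕ)
open import Data.Fin.Permutation using (Permutation′; _⟨$⟩ʳ_)
open import Data.List using (List; length; filterᵇ; allFin)
open import Data.Bool using (Bool; _∧_; if_then_else_)
open import Data.Product using (Σ; _×_; ∃; ∃-syntax)
open import Data.Sum using (_⊎_)
open import Relation.Nullary using (¬_)
open import Relation.Binary.PropositionalEquality using (_≡_)

-- Positions 1..n are represented by Fin n (0-based: position p ↦ toℕ p + 1);
-- the one-line word of ω is p ↦ ω(p).  Only relative order matters.

val : ∀ {n} → Permutation′ n → Fin n → ℕ
val ω p = toℕ (ω ⟨$⟩ʳ p)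

countᵇ : ∀ {n} → (Fin n → Bool) → ℕ
countᵇ {n} P = length (filterᵇ P (allFin n))

cc : ∀ {n} → Permutation′ n → Fin n → ℕ
cc ω i = countᵇ (λ j → (toℕ i <ᵇ toℕ j) ∧ (val ω j <ᵇ val ω i))

cc2 : ∀ {n} → Permutation′ n → Fin n → Fin n → ℕ
cc2 ω i j = countᵇ (λ k → (toℕ i <ᵇ toℕ k) ∧ (toℕ k <ᵇ toℕ j) ∧ (val ω k <ᵇ val ω i))

-- m_{i,x}(ω) ∈ ℕ^n, as a function of the coordinate j
--   j < i                      : 0
--   j = i                      : x
--   j > i, (i,j) ∈ Inv(ω)      : 0
--   j > i, (i,j) ∉ Inv(ω)      : max{0, x - c_{i,j}(ω)} = x ∸ c_{i,j}(ω)
mvec : ∀ {n} → Permutation′ n → Fin n → ℕ → Fin n → ℕ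
mvec ω i x j =
  if toℕ j <ᵇ toℕ i then 0
  else if toℕ i <ᵇ toℕ j then
    (if val ω j <ᵇ val ω i then 0 else x ∸ cc2 ω i j)
  else x

_≤ᶜ_ : ∀ {n} → (Fin n → ℕ) → (Fin n → ℕ) → Set
u ≤ᶜ v = ∀ j → u j ≤ v j

_>ᶜ_ : ∀ {n} → (Fin n → ℕ) → (Fin n → ℕ) → Set
u >ᶜ v = (v ≤ᶜ u) × ¬ (∀ j → u j ≡ v j)

Comparable : ∀ {n} → (Fin n → ℕ) → (Fin n → ℕ) → Set
Comparable u v = (u ≤ᶜ v) ⊎ (v ≤ᶜ u)

PatternData : ∀ {n} → Permutation′ n → Fin n → Fin n → ℕ → ℕ → ℕ → ℕ → Set
PatternData ω i j a b c d =
  (toℕ i < toℕ j) ×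
  (1 ≤ b) × (b < a) × (a ≤ cc ω i) ×
  (1 ≤ c) × (c < d) × (d ≤ cc ω j) ×
  (a + c ≡ b + d) ×
  (mvec ω i a >ᶜ mvec ω j d) ×
  (mvec ω i b >ᶜ mvec ω j c)

HasParallelogramPattern : ∀ {n} → Permutation′ n → Set
HasParallelogramPattern ω =
  ∃[ i ] ∃[ j ] ∃[ a ] ∃[ b ] ∃[ c ] ∃[ d ]
    (PatternData ω i j a b c d × ¬ Comparable (mvec ω i b) (mvec ω j d))

HasC4ParallelogramPattern : ∀ {n} → Permutation′ n → Set
HasC4ParallelogramPattern ω =
  ∃[ i ] ∃[ j ] ∃[ a ] ∃[ b ] ∃[ c ] ∃[ d ]
    (PatternData ω i j a b c d × Comparable (mvec ω i b) (mvec ω j d))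

-- For i < j with ω(i) < ω(j) and t = c_{i,j}(ω), every position k > j beaten by ω(i)
-- lies before j or is beaten by ω(j), so c_{i,k} ≤ t + c_{j,k} and m_{j,x} < m_{i,x+t}
-- for all x ≥ 1.  In a C₄-parallelogram-pattern coordinate i forbids m_{i,b} ≤ m_{j,d},
-- so m_{j,d} ≤ m_{i,b}; coordinate j then gives ω(i) < ω(j) and d + t ≤ b < a ≤ c_i.
-- Hence m_{i,d+t}, m_{i,c+t}, m_{j,c}, m_{j,d} form a pattern in which m_{i,c+t} and
-- m_{j,d} are incomparable: the first is larger at coordinate i and smaller (c < d) at j.
module Submission where

open import Defs
open import Data.Nat using (ℕ; _+_; _∸_; _≤_; _<_; _<ᵇ_; z≤n; s≤s)
open import Data.Nat.Properties
open import Algebra.Properties.CommutativeSemigroup +-commutativeSemigroup using (xy∙z≈zy∙x)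
open import Data.Fin using (Fin; toℕ)
open import Data.Fin.Properties using (toℕ-injective)
open import Data.Fin.Permutation using (Permutation′)
open import Data.List using ([]; _∷_; length; filterᵇ; allFin)
open import Data.List.Properties using (filter-accept)
open import Data.Bool using (Bool; true; false; _∧_; T; T?)
open import Data.Bool.Properties using (T-≡; T-∧; ¬-not)
open import Data.Product using (_×_; _,_)
open import Data.Sum using (_⊎_; inj₁; inj₂)
open import Function using (_∘_)
open import Function.Bundles using (Equivalence)
open import Relation.Nullary using (¬_; yes; no; contradiction)
open import Relation.Binary using (tri<; tri≈; tri>)
open import Relation.Binary.PropositionalEquality using (_≡_; refl; subst; subst₂; cong; trans)

open Equivalence using (to; from)

<⇒<ᵇ≡true : ∀ {m n} → m < n → (m <ᵇ n) ≡ true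
<⇒<ᵇ≡true = to T-≡ ∘ <⇒<ᵇ

≮⇒<ᵇ≡false : ∀ {m n} → ¬ m < n → (m <ᵇ n) ≡ false
≮⇒<ᵇ≡false {m} {n} m≮n = ¬-not (m≮n ∘ <ᵇ⇒< m n ∘ from T-≡)

length-filterᵇ-∷ : ∀ {A : Set} (p : A → Bool) x xs →
  length (filterᵇ p xs) ≤ length (filterᵇ p (x ∷ xs))
length-filterᵇ-∷ p x xs with p x
... | true  = n≤1+n _
... | false = ≤-refl

length-filterᵇ-≤-+ : ∀ {A : Set} (p q r : A → Bool) →
  (∀ x → T (p x) → T (q x) ⊎ T (r x)) →
  ∀ xs → length (filterᵇ p xs) ≤ length (filterᵇ q xs) + length (filterᵇ r xs)
length-filterᵇ-≤-+ p q r p⇒q∨r []       = z≤n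
length-filterᵇ-≤-+ p q r p⇒q∨r (x ∷ xs)
  with ih ← length-filterᵇ-≤-+ p q r p⇒q∨r xs | p x in px
... | false = ≤-trans ih (+-mono-≤ (length-filterᵇ-∷ q x xs) (length-filterᵇ-∷ r x xs))
... | true with p⇒q∨r x (from T-≡ px)
...   | inj₁ qx rewrite filter-accept (T? ∘ q) {xs = xs} qx =
  s≤s (≤-trans ih (+-monoʳ-≤ _ (length-filterᵇ-∷ r x xs)))
...   | inj₂ rx rewrite filter-accept (T? ∘ r) {xs = xs} rx
                      | +-suc (length (filterᵇ q (x ∷ xs))) (length (filterᵇ r xs)) =
  s≤s (≤-trans ih (+-monoˡ-≤ _ (length-filterᵇ-∷ q x xs)))

m∸o≤m+n∸p : ∀ m n {o p} → p ≤ n + o → m ∸ o ≤ m + n ∸ p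
m∸o≤m+n∸p m n {o} {p} p≤n+o = begin
  m ∸ o             ≡⟨ cong (_∸ o) (m+n∸n≡m m n) ⟨
  m + n ∸ n ∸ o     ≡⟨ ∸-+-assoc (m + n) n o ⟩
  m + n ∸ (n + o)   ≤⟨ ∸-monoʳ-≤ (m + n) p≤n+o ⟩
  m + n ∸ p         ∎
  where open ≤-Reasoning

module _ {n : ℕ} (ω : Permutation′ n) where

  mvec-< : ∀ i x k → toℕ k < toℕ i → mvec ω i x k ≡ 0
  mvec-< i x k k<i rewrite <⇒<ᵇ≡true k<i = refl

  mvec-diag : ∀ i x → mvec ω i x i ≡ x
  mvec-diag i x rewrite ≮⇒<ᵇ≡false (n≮n (toℕ i)) = refl

  mvec-inv : ∀ i x k → toℕ i < toℕ k → val ω k < val ω i → mvec ω i x k ≡ 0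
  mvec-inv i x k i<k ωk<ωi
    rewrite ≮⇒<ᵇ≡false (<⇒≯ i<k) | <⇒<ᵇ≡true i<k | <⇒<ᵇ≡true ωk<ωi = refl

  mvec-noninv : ∀ i x k → toℕ i < toℕ k → ¬ val ω k < val ω i →
    mvec ω i x k ≡ x ∸ cc2 ω i k
  mvec-noninv i x k i<k ωk≮ωi
    rewrite ≮⇒<ᵇ≡false (<⇒≯ i<k) | <⇒<ᵇ≡true i<k | ≮⇒<ᵇ≡false ωk≮ωi = refl

  Beaten : Fin n → Fin n → Fin n → Bool
  Beaten i k l = (toℕ i <ᵇ toℕ l) ∧ (toℕ l <ᵇ toℕ k) ∧ (val ω l <ᵇ val ω i)

  Beaten⇒ : ∀ i k l → T (Beaten i k l) → toℕ i < toℕ l × toℕ l < toℕ k × val ω l < val ω i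
  Beaten⇒ i k l b with to T-∧ b
  ... | i<l , b′ with to T-∧ b′
  ...   | l<k , ωl<ωi = <ᵇ⇒< _ _ i<l , <ᵇ⇒< _ _ l<k , <ᵇ⇒< _ _ ωl<ωi

  ⇒Beaten : ∀ i k l → toℕ i < toℕ l → toℕ l < toℕ k → val ω l < val ω i → T (Beaten i k l)
  ⇒Beaten i k l i<l l<k ωl<ωi = from T-∧ (<⇒<ᵇ i<l , from T-∧ (<⇒<ᵇ l<k , <⇒<ᵇ ωl<ωi))

  cc2-≤-+ : ∀ i j k → toℕ i < toℕ j → toℕ j < toℕ k → ¬ val ω j < val ω i →
    cc2 ω i k ≤ cc2 ω i j + cc2 ω j k
  cc2-≤-+ i j k i<j j<k ωj≮ωi =
    length-filterᵇ-≤-+ (Beaten i k) (Beaten i j) (Beaten j k) split (allFin n)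
    where
    split : ∀ l → T (Beaten i k l) → T (Beaten i j l) ⊎ T (Beaten j k l)
    split l b with Beaten⇒ i k l b
    ... | i<l , l<k , ωl<ωi with <-cmp (toℕ l) (toℕ j)
    ...   | tri< l<j _ _ = inj₁ (⇒Beaten i j l i<l l<j ωl<ωi)
    ...   | tri≈ _ l≡j _ =
      contradiction (subst (λ m → val ω m < val ω i) (toℕ-injective l≡j) ωl<ωi) ωj≮ωi
    ...   | tri> _ _ j<l = inj₂ (⇒Beaten j k l j<l l<k (<-≤-trans ωl<ωi (≮⇒≥ ωj≮ωi)))

  mvec-≤ᶜ-shift : ∀ i j x → toℕ i < toℕ j → ¬ val ω j < val ω i →
    mvec ω j x ≤ᶜ mvec ω i (x + cc2 ω i j)
  mvec-≤ᶜ-shift i j x i<j ωj≮ωi k with <-cmp (toℕ k) (toℕ j)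
  ... | tri< k<j _ _ rewrite mvec-< j x k k<j = z≤n
  ... | tri≈ _ k≡j _ rewrite toℕ-injective k≡j | mvec-diag j x
                           | mvec-noninv i (x + cc2 ω i j) j i<j ωj≮ωi
                           | m+n∸n≡m x (cc2 ω i j) = ≤-refl
  ... | tri> _ _ j<k with val ω k <? val ω j
  ...   | yes ωk<ωj rewrite mvec-inv j x k j<k ωk<ωj = z≤n
  ...   | no ωk≮ωj rewrite mvec-noninv j x k j<k ωk≮ωj
                         | mvec-noninv i (x + cc2 ω i j) k (<-trans i<j j<k)
                             (λ ωk<ωi → ωk≮ωj (<-≤-trans ωk<ωi (≮⇒≥ ωj≮ωi))) =
    m∸o≤m+n∸p x (cc2 ω i j) (cc2-≤-+ i j k i<j j<k ωj≮ωi)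

  mvec-≰ᶜ-later : ∀ i j x y → toℕ i < toℕ j → 1 ≤ x → ¬ (mvec ω i x ≤ᶜ mvec ω j y)
  mvec-≰ᶜ-later i j x y i<j 1≤x le =
    <⇒≱ 1≤x (subst₂ _≤_ (mvec-diag i x) (mvec-< j y i i<j) (le i))

  mvec->ᶜ-shift : ∀ i j x → toℕ i < toℕ j → ¬ val ω j < val ω i → 1 ≤ x →
    mvec ω i (x + cc2 ω i j) >ᶜ mvec ω j x
  mvec->ᶜ-shift i j x i<j ωj≮ωi 1≤x =
    mvec-≤ᶜ-shift i j x i<j ωj≮ωi ,
    mvec-≰ᶜ-later i j (x + cc2 ω i j) x i<j (≤-trans 1≤x (m≤m+n x _)) ∘ (λ eq → ≤-reflexive ∘ eq)

  comparable⇒dominated : ∀ i j x y → toℕ i < toℕ j → 1 ≤ x →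
    Comparable (mvec ω i x) (mvec ω j y) → mvec ω j y ≤ᶜ mvec ω i x
  comparable⇒dominated i j x y i<j 1≤x (inj₁ le) = contradiction le (mvec-≰ᶜ-later i j x y i<j 1≤x)
  comparable⇒dominated i j x y i<j 1≤x (inj₂ le) = le

  dominated⇒noninv : ∀ i j x y → toℕ i < toℕ j → 1 ≤ y →
    mvec ω j y ≤ᶜ mvec ω i x → ¬ val ω j < val ω i
  dominated⇒noninv i j x y i<j 1≤y le ωj<ωi =
    <⇒≱ 1≤y (subst₂ _≤_ (mvec-diag j y) (mvec-inv i x j i<j ωj<ωi) (le j))

  dominated⇒shift-≤ : ∀ i j x y → toℕ i < toℕ j → 1 ≤ y →
    mvec ω j y ≤ᶜ mvec ω i x → y + cc2 ω i j ≤ x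
  dominated⇒shift-≤ i j x y i<j 1≤y le =
    m≤o∸n⇒m+n≤o y (<⇒≤ (m∸n≢0⇒n<m (n>0⇒n≢0 (≤-trans 1≤y y≤x∸t)))) y≤x∸t
    where
    y≤x∸t : y ≤ x ∸ cc2 ω i j
    y≤x∸t = subst₂ _≤_ (mvec-diag j y)
      (mvec-noninv i x j i<j (dominated⇒noninv i j x y i<j 1≤y le)) (le j)

  shift-incomparable : ∀ i j x y → toℕ i < toℕ j → ¬ val ω j < val ω i → 1 ≤ x → x < y →
    ¬ Comparable (mvec ω i (x + cc2 ω i j)) (mvec ω j y)
  shift-incomparable i j x y i<j ωj≮ωi 1≤x x<y (inj₁ le) =
    mvec-≰ᶜ-later i j (x + cc2 ω i j) y i<j (≤-trans 1≤x (m≤m+n x _)) le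
  shift-incomparable i j x y i<j ωj≮ωi 1≤x x<y (inj₂ le) =
    <⇒≱ x<y (subst₂ _≤_ (mvec-diag j y)
      (trans (mvec-noninv i (x + cc2 ω i j) j i<j ωj≮ωi) (m+n∸n≡m x (cc2 ω i j))) (le j))

mainTheorem6 : (n : ℕ) (ω : Permutation′ n) →
    HasC4ParallelogramPattern ω → HasParallelogramPattern ω
mainTheorem6 n ω
  (i , j , a , b , c , d , (i<j , 1≤b , b<a , a≤ci , 1≤c , c<d , d≤cj , _ , _ , _) , comparable) =
  i , j , d + t , c + t , c , d ,
  ( i<j , ≤-trans 1≤c (m≤m+n c t) , +-monoˡ-< t c<d , d+t≤ci , 1≤c , c<d , d≤cj
  , xy∙z≈zy∙x d t c
  , mvec->ᶜ-shift ω i j d i<j noninv 1≤d , mvec->ᶜ-shift ω i j c i<j noninv 1≤c ) ,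
  shift-incomparable ω i j c d i<j noninv 1≤c c<d
  where
  t : ℕ
  t = cc2 ω i j
  1≤d : 1 ≤ d
  1≤d = ≤-trans 1≤c (<⇒≤ c<d)
  dominated : mvec ω j d ≤ᶜ mvec ω i b
  dominated = comparable⇒dominated ω i j b d i<j 1≤b comparable
  noninv : ¬ val ω j < val ω i
  noninv = dominated⇒noninv ω i j b d i<j 1≤d dominated
  d+t≤ci : d + t ≤ cc ω i
  d+t≤ci = ≤-trans (dominated⇒shift-≤ ω i j b d i<j 1≤d dominated) (≤-trans (<⇒≤ b<a) a≤ci)
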